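{- Let $k \in \mathbb{N}$. For every $n \in \mathbb{N}$, the positive integer $$d = \left[\begin{array}{c} n+k \\ n \end{array}\right] = \frac{\mathrm{lcm}(k+1, k+2, \dots, k+n)}{\mathrm{lcm}(1, 2, \dots, n)}$$ satisfies $\Omega(d) \leq k$.
   Context: $\mathbb{N}$ denotes the set of nonnegative integers. For $N \geq m \geq 0$, $\left[\begin{smallmatrix} N \\ m\end{smallmatrix}\right] := \mathrm{lcm}(N, N-1, \dots, N-m+1)/\mathrm{lcm}(1, 2, \dots, m)$, with the lcm of the empty set equal to $1$; this is a positive integer. The set of numbers $\left[\begin{smallmatrix} n+k \\ n\end{smallmatrix}\right]$, $n \in \mathbb{N}$, is called the $(k+1)$-th diagonal $D_k$ of the lcm-binomial triangle. For a positive integer $d$, $\Omega(d)$ is the number of prime factors of $d$ counted with multiplicity. -}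

module Defs where

open import Data.Nat.Base
open import Data.Nat.LCM using (lcm; gcd*lcm)
open import Data.Nat.GCD using (gcd)
open import Data.Nat.DivMod using (_/_)
open import Data.Nat.Properties using (*-zeroʳ)
open import Data.List.Base using (length)
open import Data.Nat.Primality.Factorisation using (factorise; factors)
open import Relation.Binary.PropositionalEquality using (_≡_; refl; trans; sym; cong)

lcmRange : ℕ → ℕ → ℕ
lcmRange a zero    = 1
lcmRange a (suc m) = lcm (a + suc m) (lcmRange a m)

lcm-nonZero : ∀ m n → .{{NonZero m}} → .{{NonZero n}} → NonZero (lcm m n)
lcm-nonZero (suc m) (suc n) with lcm (suc m) (suc n) in eq
... | suc _ = _
... | zero  with () ← trans (sym (*-zeroʳ (gcd (suc m) (suc n))))
                       (trans (cong (gcd (suc m) (suc n) *_) (sym eq)) (gcd*lcm (suc m) (suc n)))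

a+suc-nz : ∀ a m → NonZero (a + suc m)
a+suc-nz zero    m = _
a+suc-nz (suc a) m = _

lcmRange-nz : ∀ a m → NonZero (lcmRange a m)
lcmRange-nz a zero    = _
lcmRange-nz a (suc m) =
  lcm-nonZero (a + suc m) (lcmRange a m) {{a+suc-nz a m}} {{lcmRange-nz a m}}

-- the lcm-binomial [N over m] = lcm(N, N-1, ..., N-m+1) / lcm(1, ..., m), for N ≥ m;
-- here written with N = m + a: lcm(a+1, ..., a+m) / lcm(1, ..., m)
lcmBinom : (a m : ℕ) → ℕ
lcmBinom a m = (lcmRange a m / lcmRange 0 m) {{lcmRange-nz 0 m}}

-- Convention Ω(0) = 0 (never used: the argument below is always positive).
Ω : ℕ → ℕ
Ω zero    = 0
Ω (suc d) = length (factors (factorise (suc d)))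

{-# OPTIONS --safe #-}
-- Write L(m) = lcm(1, …, m). Each step L(m) ∣ L(m+1) multiplies by 1 or by a prime p ∣ m+1, since
-- (m+1)/p ≤ m already divides L(m); hence L(k+n) ∣ c · L(n) with Ω(c) ≤ k. Every i ≤ n divides one
-- of k+1, …, k+i, so L(n) ∣ lcm(k+1, …, k+n) ∣ L(k+n), and the lcm-binomial
-- lcm(k+1, …, k+n) / L(n) divides c. Finally Ω is additive, hence monotone under divisibility.
module Submission where

open import Defs
open import Data.Nat.Base
  using (ℕ; _≤_; zero; suc; _+_; _*_; _∸_; _<_; z≤n; s≤s; NonZero; nonTrivial⇒n>1)
open import Data.Nat.Properties
open import Data.Nat.Divisibility
open import Data.Nat.DivMod using (_/_; _%_; m≡m%n+[m/n]*n; m%n<n; m/n<m; m≥n⇒m/n>0)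
open import Data.Nat.LCM using (lcm; lcm-least; m∣lcm[m,n]; n∣lcm[m,n])
open import Data.Nat.ListAction using (product)
open import Data.Nat.ListAction.Properties using (product-++)
open import Data.Nat.Primality using (Prime; prime⇒nonZero; prime⇒nonTrivial)
open import Data.Nat.Primality.Factorisation
  using (PrimeFactorisation; factorise; factors; factorisationUnique; primeFactorisation[p])
open import Data.List.Base using ([]; _∷_; _++_; length)
open import Data.List.Properties using (length-++)
open import Data.List.Relation.Unary.All using (_∷_)
open import Data.List.Relation.Unary.All.Properties using (++⁺)
open import Data.List.Relation.Binary.Permutation.Propositional.Properties using (↭-length)
open import Data.Product using (∃; _×_; _,_)
open import Data.Sum using (inj₁; inj₂)
open import Relation.Binary.PropositionalEquality

open PrimeFactorisation

Ω-factorisation : ∀ {n} .{{_ : NonZero n}} (f : PrimeFactorisation n) → Ω n ≡ length (factors f)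
Ω-factorisation {suc n} f = ↭-length (factorisationUnique (factorise (suc n)) f)

_*ᶠ_ : ∀ {m n} → PrimeFactorisation m → PrimeFactorisation n → PrimeFactorisation (m * n)
f *ᶠ g = record
  { factors         = factors f ++ factors g
  ; isFactorisation = trans (cong₂ _*_ (isFactorisation f) (isFactorisation g))
                            (sym (product-++ (factors f) (factors g)))
  ; factorsPrime    = ++⁺ (factorsPrime f) (factorsPrime g)
  }

Ω-* : ∀ m n .{{_ : NonZero m}} .{{_ : NonZero n}} → Ω (m * n) ≡ Ω m + Ω n
Ω-* m n = begin
  Ω (m * n)                                  ≡⟨ Ω-factorisation {{m*n≢0 m n}} (fm *ᶠ fn) ⟩
  length (factors fm ++ factors fn)          ≡⟨ length-++ (factors fm) ⟩
  length (factors fm) + length (factors fn)  ≡⟨ cong₂ _+_ (Ω-factorisation fm) (Ω-factorisation fn) ⟨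
  Ω m + Ω n                                  ∎
  where
  open ≡-Reasoning
  fm = factorise m
  fn = factorise n

Ω-prime : ∀ {p} → Prime p → Ω p ≡ 1
Ω-prime pp = Ω-factorisation {{prime⇒nonZero pp}} (primeFactorisation[p] pp)

Ω-mono-∣ : ∀ {m n} .{{_ : NonZero n}} → m ∣ n → Ω m ≤ Ω n
Ω-mono-∣ {m} (divides q refl) = begin
  Ω m          ≤⟨ m≤n+m (Ω m) (Ω q) ⟩
  Ω q + Ω m    ≡⟨ Ω-* q m {{m*n≢0⇒m≢0 q}} {{m*n≢0⇒n≢0 q}} ⟨
  Ω (q * m)    ∎
  where open ≤-Reasoning

primeFactor : ∀ m → ∃ λ p → Prime p × p ∣ suc (suc m)
primeFactor m with factorise (suc (suc m))
... | record { factors = [] ; isFactorisation = () }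
... | record { factors = p ∷ ps ; isFactorisation = eq ; factorsPrime = pp ∷ _ } =
  p , pp , subst (p ∣_) (sym eq) (m∣m*n (product ps))

∣lcmRange : ∀ a {n j} → j < n → a + suc j ∣ lcmRange a n
∣lcmRange a {suc n} {j} (s≤s j≤n) with m≤n⇒m<n∨m≡n j≤n
... | inj₁ j<n = ∣-trans (∣lcmRange a j<n) (n∣lcm[m,n] (a + suc n) (lcmRange a n))
... | inj₂ refl = m∣lcm[m,n] (a + suc n) (lcmRange a n)

lcmRange-least : ∀ a n {x} → (∀ {j} → j < n → a + suc j ∣ x) → lcmRange a n ∣ x
lcmRange-least a zero    h = 1∣ _
lcmRange-least a (suc n) h = lcm-least (h ≤-refl) (lcmRange-least a n (λ j<n → h (m<n⇒m<1+n j<n)))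

∣lcmUpTo : ∀ {i n} → 0 < i → i < suc n → i ∣ lcmRange 0 n
∣lcmUpTo {suc j} _ (s≤s j<n) = ∣lcmRange 0 j<n

-- The witness is j = i ∸ (k mod (1+i)), which makes k + 1 + j the next multiple of 1 + i after k.
∃-multiple-in-window : ∀ k i → ∃ λ j → j ≤ i × suc i ∣ k + suc j
∃-multiple-in-window k i = i ∸ r , m∸n≤m i r , divides (suc q) k+suc[i∸r]≡
  where
  r = k % suc i
  q = k / suc i
  k+suc[i∸r]≡ : k + suc (i ∸ r) ≡ suc q * suc i
  k+suc[i∸r]≡ = begin
    k + suc (i ∸ r)                ≡⟨ cong (_+ suc (i ∸ r)) (m≡m%n+[m/n]*n k (suc i)) ⟩
    r + q * suc i + suc (i ∸ r)    ≡⟨ cong (_+ suc (i ∸ r)) (+-comm r (q * suc i)) ⟩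
    q * suc i + r + suc (i ∸ r)    ≡⟨ +-assoc (q * suc i) r (suc (i ∸ r)) ⟩
    q * suc i + (r + suc (i ∸ r))  ≡⟨ cong (q * suc i +_) (+-suc r (i ∸ r)) ⟩
    q * suc i + suc (r + (i ∸ r))  ≡⟨ cong (λ x → q * suc i + suc x) (m+[n∸m]≡n (≤-pred (m%n<n k (suc i)))) ⟩
    q * suc i + suc i              ≡⟨ +-comm (q * suc i) (suc i) ⟩
    suc q * suc i                  ∎
    where open ≡-Reasoning

lcmUpTo∣lcmRange : ∀ k n → lcmRange 0 n ∣ lcmRange k n
lcmUpTo∣lcmRange k n = lcmRange-least 0 n λ {i} i<n →
  let (j , j≤i , 1+i∣k+1+j) = ∃-multiple-in-window k i in
  ∣-trans 1+i∣k+1+j (∣lcmRange k (≤-<-trans j≤i i<n))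

lcmRange∣lcmUpTo : ∀ k n → lcmRange k n ∣ lcmRange 0 (k + n)
lcmRange∣lcmUpTo k n = lcmRange-least k n λ {j} j<n →
  subst (_∣ lcmRange 0 (k + n)) (sym (+-suc k j)) (∣lcmRange 0 (+-monoʳ-< k j<n))

lcmUpTo-suc∣ : ∀ m {p} → Prime p → p ∣ suc m → lcmRange 0 (suc m) ∣ p * lcmRange 0 m
lcmUpTo-suc∣ m {p} pp p∣1+m = lcm-least 1+m∣p*L (n∣m*n p)
  where
  instance _ = prime⇒nonZero pp; _ = prime⇒nonTrivial pp
  1+m∣p*L : suc m ∣ p * lcmRange 0 m
  1+m∣p*L = subst (suc m ∣_) (*-comm (lcmRange 0 m) p) (m/n∣o⇒m∣o*n p∣1+m
    (∣lcmUpTo (m≥n⇒m/n>0 (∣⇒≤ p∣1+m)) (m/n<m (suc m) p (nonTrivial⇒n>1 p))))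

lcmUpTo-suc-growth : ∀ m → ∃ λ c → NonZero c × Ω c ≤ 1 × lcmRange 0 (suc m) ∣ c * lcmRange 0 m
lcmUpTo-suc-growth zero    = 1 , _ , z≤n , ∣-refl
lcmUpTo-suc-growth (suc m) with primeFactor m
... | p , pp , p∣2+m =
  p , prime⇒nonZero pp , ≤-reflexive (Ω-prime pp) , lcmUpTo-suc∣ (suc m) pp p∣2+m

lcmUpTo-+-growth : ∀ j n → ∃ λ c → NonZero c × Ω c ≤ j × lcmRange 0 (j + n) ∣ c * lcmRange 0 n
lcmUpTo-+-growth zero    n = 1 , _ , ≤-refl , ∣-reflexive (sym (*-identityˡ (lcmRange 0 n)))
lcmUpTo-+-growth (suc j) n with lcmUpTo-+-growth j n | lcmUpTo-suc-growth (j + n)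
... | c , c≢0 , Ωc≤j , L[j+n]∣c*L | c′ , c′≢0 , Ωc′≤1 , L[1+j+n]∣c′*L =
  let instance _ = c≢0; _ = c′≢0 in
  c′ * c , m*n≢0 c′ c ,
  ≤-trans (≤-reflexive (Ω-* c′ c)) (+-mono-≤ Ωc′≤1 Ωc≤j) ,
  ∣-trans L[1+j+n]∣c′*L
    (subst (c′ * lcmRange 0 (j + n) ∣_) (sym (*-assoc c′ c (lcmRange 0 n))) (*-monoʳ-∣ c′ L[j+n]∣c*L))

proposition2 : (k n : ℕ) → Ω (lcmBinom k n) ≤ k
proposition2 k n with lcmUpTo-+-growth k n
... | c , c≢0 , Ωc≤k , L[k+n]∣c*L = ≤-trans (Ω-mono-∣ {{c≢0}} lcmBinom∣c) Ωc≤k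
  where
  instance _ = lcmRange-nz 0 n
  lcmBinom∣c : lcmBinom k n ∣ c
  lcmBinom∣c = m∣n*o⇒m/n∣o (lcmUpTo∣lcmRange k n) (∣-trans (lcmRange∣lcmUpTo k n) L[k+n]∣c*L)
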